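{- Let $q$ be a positive integer and $t_1,\dots,t_q$ complex numbers. Define $b(h)$ and $a(\ell)$ by $$\sum_{h=0}^{2q}b(h)x^h=\prod_{j=1}^{q}(x^2+t_jx+t_j),\qquad \sum_{\ell=0}^{q}a(\ell)y^\ell=\prod_{j=1}^{q}(y+t_j).$$ Then for every $h$ with $0\le h\le 2q$, $$b(h)=\sum_{\ell=\max\{0,h-q\}}^{\lfloor h/2\rfloor}\binom{q-\ell}{h-2\ell}a(\ell).$$ -}

module Defs where

open import Level using (Level)
open import Algebra.Bundles using (CommutativeRing)
open import Data.Nat using (ℕ; zero; suc; _∸_)
open import Data.Fin using (Fin; zero; suc)
open import Data.List using (List; []; _∷_; map)
open import Function using (_∘_)

-- Polynomials over a commutative ring R, as lists of coefficients
-- (constant coefficient first).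
module PolyDefs {c ℓ : Level} (R : CommutativeRing c ℓ) where
  open CommutativeRing R using (Carrier; _+_; _*_; 0#; 1#)

  Poly : Set c
  Poly = List Carrier

  coeff : Poly → ℕ → Carrier
  coeff []       _       = 0#
  coeff (a ∷ as) zero    = a
  coeff (a ∷ as) (suc h) = coeff as h

  polyAdd : Poly → Poly → Poly
  polyAdd []       ys       = ys
  polyAdd (x ∷ xs) []       = x ∷ xs
  polyAdd (x ∷ xs) (y ∷ ys) = (x + y) ∷ polyAdd xs ys

  polyMul : Poly → Poly → Poly
  polyMul []       ys = []
  polyMul (x ∷ xs) ys = polyAdd (map (x *_) ys) (0# ∷ polyMul xs ys)

  polyProd : (q : ℕ) → (Fin q → Poly) → Poly
  polyProd zero    f = 1# ∷ []
  polyProd (suc q) f = polyMul (f zero) (polyProd q (f ∘ suc))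

  _·_ : ℕ → Carrier → Carrier
  zero  · a = 0#
  suc n · a = a + (n · a)

  -- Σ_{ℓ = lo}^{hi} f ℓ  (empty sum if hi < lo)
  sumFrom : ℕ → ℕ → (ℕ → Carrier) → Carrier
  sumFrom lo zero    f = 0#
  sumFrom lo (suc k) f = f lo + sumFrom (suc lo) k f

  sumRange : ℕ → ℕ → (ℕ → Carrier) → Carrier
  sumRange lo hi f = sumFrom lo (suc hi ∸ lo) f

  quadFactor : Carrier → Poly
  quadFactor t = t ∷ t ∷ 1# ∷ []

  linFactor : Carrier → Poly
  linFactor t = t ∷ 1# ∷ []

  b : (q : ℕ) → (Fin q → Carrier) → ℕ → Carrier
  b q t h = coeff (polyProd q (quadFactor ∘ t)) h

  a : (q : ℕ) → (Fin q → Carrier) → ℕ → Carrier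
  a q t l = coeff (polyProd q (linFactor ∘ t)) l

-- Since x² + t x + t = x² + t (1 + x), expanding the product over j gives
--   Σ_h b(h) xʰ = Σ_ℓ a(ℓ) x²ˡ (1 + x)^(q − ℓ).
-- This is proved coefficientwise by induction on q: multiplying by one more factor
-- x² + t (1 + x) acts on both sides in the same way, on the right by Pascal's rule.
-- The coefficient of xʰ in a(ℓ) x²ˡ (1 + x)^(q − ℓ) is C(q − ℓ, h − 2ℓ) a(ℓ) when 2ℓ ≤ h
-- and 0 otherwise, and the binomial also vanishes when ℓ < h − q.
module Submission where

open import Level using (Level)
open import Algebra.Bundles using (CommutativeRing)
import Algebra.Properties.Semiring.Mult as SemiringMult
open import Data.Fin using (Fin; zero; suc)
open import Data.List using ([]; _∷_; map)
open import Data.Nat as ℕ using (ℕ; zero; suc; _≤_; _<_; _∸_; _/_; s≤s; z<s; _≤?_; _<?_)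
open import Data.Nat.Combinatorics using (_C_; k>n⇒nCk≡0; nCk+nC[k+1]≡[n+1]C[k+1])
import Data.Nat.Properties as ℕₚ
open import Function using (_∘_)
open import Relation.Binary.PropositionalEquality as ≡ using (_≡_)
open import Relation.Nullary using (yes; no)
open import Defs

module ShiftedBinomial where
  open import Data.Nat using (_+_; _*_)
  open import Data.Nat.Properties using (+-comm; +-identityʳ; *-suc; m∸n≢0⇒n<m; m<n⇒n≢0; <⇒≤)
  open ≡ using (refl; sym; trans)

  -- The coefficient of xʰ in x²ˡ (1 + x)ᵐ.
  shiftedBinomial : ℕ → ℕ → ℕ → ℕ
  shiftedBinomial m zero    h             = m C h
  shiftedBinomial m (suc l) zero          = 0
  shiftedBinomial m (suc l) (suc zero)    = 0
  shiftedBinomial m (suc l) (suc (suc h)) = shiftedBinomial m l h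

  shiftedBinomial-pascal₀ : ∀ m l → shiftedBinomial (suc m) l 0 ≡ shiftedBinomial m l 0
  shiftedBinomial-pascal₀ m zero    = refl
  shiftedBinomial-pascal₀ m (suc l) = refl

  shiftedBinomial-pascal : ∀ m l h →
    shiftedBinomial (suc m) l (suc h) ≡ shiftedBinomial m l (suc h) + shiftedBinomial m l h
  shiftedBinomial-pascal m zero    h             =
    trans (sym (nCk+nC[k+1]≡[n+1]C[k+1] m h)) (+-comm (m C h) (m C suc h))
  shiftedBinomial-pascal m (suc l) zero          = refl
  shiftedBinomial-pascal m (suc l) (suc zero)    =
    trans (shiftedBinomial-pascal₀ m l) (sym (+-identityʳ _))
  shiftedBinomial-pascal m (suc l) (suc (suc h)) = shiftedBinomial-pascal m l h

  2*l≤h⇒shiftedBinomial≡C : ∀ {m} l {h} → 2 * l ≤ h → shiftedBinomial m l h ≡ m C (h ∸ 2 * l)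
  2*l≤h⇒shiftedBinomial≡C zero    _ = refl
  2*l≤h⇒shiftedBinomial≡C (suc l) {h} 2*[1+l]≤h rewrite *-suc 2 l with h | 2*[1+l]≤h
  ... | suc (suc h) | s≤s (s≤s 2*l≤h) = 2*l≤h⇒shiftedBinomial≡C l 2*l≤h

  h<2*l⇒shiftedBinomial≡0 : ∀ {m} l {h} → h < 2 * l → shiftedBinomial m l h ≡ 0
  h<2*l⇒shiftedBinomial≡0 (suc l) {zero}        _ = refl
  h<2*l⇒shiftedBinomial≡0 (suc l) {suc zero}    _ = refl
  h<2*l⇒shiftedBinomial≡0 (suc l) {suc (suc h)} h+2<2*[1+l] rewrite *-suc 2 l with h+2<2*[1+l]
  ... | s≤s (s≤s h<2*l) = h<2*l⇒shiftedBinomial≡0 l h<2*l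

  m<h∸2*l⇒shiftedBinomial≡0 : ∀ {m} l {h} → m < h ∸ 2 * l → shiftedBinomial m l h ≡ 0
  m<h∸2*l⇒shiftedBinomial≡0 l m<h∸2*l = trans
    (2*l≤h⇒shiftedBinomial≡C l (<⇒≤ (m∸n≢0⇒n<m (m<n⇒n≢0 m<h∸2*l))))
    (k>n⇒nCk≡0 m<h∸2*l)

module IndexBounds where
  open import Data.Nat using (_+_; _*_)
  open import Data.Nat.Properties
  open import Data.Nat.DivMod using (m/n*n≤m; m*n/n≡m; /-monoˡ-≤)
  open ≡ using (sym; trans; cong; subst)

  m≤n/2⇒2*m≤n : ∀ {m n} → m ≤ n / 2 → 2 * m ≤ n
  m≤n/2⇒2*m≤n {m} {n} m≤n/2 =
    ≤-trans (*-monoʳ-≤ 2 m≤n/2) (subst (_≤ n) (*-comm (n / 2) 2) (m/n*n≤m n 2))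

  n/2<m⇒n<2*m : ∀ {m n} → n / 2 < m → n < 2 * m
  n/2<m⇒n<2*m {m} {n} n/2<m = ≰⇒> λ 2*m≤n →
    <⇒≱ n/2<m (subst (_≤ n / 2) (m*n/n≡m m 2) (/-monoˡ-≤ 2 (subst (_≤ n) (*-comm 2 m) 2*m≤n)))

  m<n∸o⇒o<n∸m : ∀ {m n o} → m < n ∸ o → o < n ∸ m
  m<n∸o⇒o<n∸m {m} {n} {o} m<n∸o =
    m+n≤o⇒m≤o∸n (suc o) (subst (_≤ n) (cong suc (+-comm m o)) (m≤o∸n⇒m+n≤o (suc m) o≤n m<n∸o))
    where
    o≤n : o ≤ n
    o≤n = <⇒≤ (m∸n≢0⇒n<m (m<n⇒n≢0 m<n∸o))

  n≤2*o⇒m<n∸o⇒o∸m<n∸2*m : ∀ {m n o} → n ≤ 2 * o → m < n ∸ o → o ∸ m < n ∸ 2 * m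
  n≤2*o⇒m<n∸o⇒o∸m<n∸2*m {m} {n} {o} n≤2*o m<n∸o =
    subst (o ∸ m <_) n∸m∸m≡n∸2*m (∸-monoˡ-< (m<n∸o⇒o<n∸m m<n∸o) m≤o)
    where
    m≤o : m ≤ o
    m≤o = <⇒≤ (<-≤-trans m<n∸o (m≤n+o⇒m∸n≤o n o (subst (n ≤_) (cong (o +_) (+-identityʳ o)) n≤2*o)))
    n∸m∸m≡n∸2*m : n ∸ m ∸ m ≡ n ∸ 2 * m
    n∸m∸m≡n∸2*m = trans (∸-+-assoc n m m) (cong (λ k → n ∸ (m + k)) (sym (+-identityʳ m)))

open ShiftedBinomial
open IndexBounds

module Expansion {c ℓ : Level} (R : CommutativeRing c ℓ) where
  open CommutativeRing R hiding (zero)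
  open PolyDefs R
  open SemiringMult semiring using (_×_; ×-congʳ; ×-congˡ; ×-homo-+; ×-comm-*)
  open import Algebra.Properties.CommutativeMonoid.Mult +-commutativeMonoid using (×-distrib-+)
  open import Algebra.Properties.CommutativeSemigroup +-commutativeSemigroup using (interchange)
  open import Relation.Binary.Reasoning.Setoid setoid

  ·≡× : ∀ n x → n · x ≡ n × x
  ·≡× zero    x = ≡.refl
  ·≡× (suc n) x = ≡.cong (x +_) (·≡× n x)

  ×-zeroʳ : ∀ n → n × 0# ≈ 0#
  ×-zeroʳ zero    = refl
  ×-zeroʳ (suc n) = trans (+-identityˡ _) (×-zeroʳ n)

  Series : Set c
  Series = ℕ → Carrier

  shift : Series → Series
  shift f zero    = 0#
  shift f (suc n) = f n

  shift-cong : ∀ {f g : Series} → (∀ n → f n ≈ g n) → ∀ n → shift f n ≈ shift g n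
  shift-cong f≈g zero    = refl
  shift-cong f≈g (suc n) = f≈g n

  shift-0# : ∀ n → shift (λ _ → 0#) n ≈ 0#
  shift-0# zero    = refl
  shift-0# (suc n) = refl

  sumFrom-cong : ∀ lo k {f g : Series} → (∀ {l} → lo ≤ l → l < lo ℕ.+ k → f l ≈ g l) →
    sumFrom lo k f ≈ sumFrom lo k g
  sumFrom-cong lo zero    f≈g = refl
  sumFrom-cong lo (suc k) f≈g = +-cong (f≈g ℕₚ.≤-refl (ℕₚ.m<m+n lo z<s))
    (sumFrom-cong (suc lo) k λ {l} lo<l l<1+lo+k →
      f≈g (ℕₚ.<⇒≤ lo<l) (≡.subst (l <_) (≡.sym (ℕₚ.+-suc lo k)) l<1+lo+k))

  sumFrom-0# : ∀ lo k → sumFrom lo k (λ _ → 0#) ≈ 0#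
  sumFrom-0# lo zero    = refl
  sumFrom-0# lo (suc k) = trans (+-identityˡ _) (sumFrom-0# (suc lo) k)

  sumFrom-zero : ∀ lo k {f : Series} → (∀ {l} → lo ≤ l → l < lo ℕ.+ k → f l ≈ 0#) →
    sumFrom lo k f ≈ 0#
  sumFrom-zero lo k f≈0 = trans (sumFrom-cong lo k f≈0) (sumFrom-0# lo k)

  sumFrom-+ : ∀ lo k (f g : Series) →
    sumFrom lo k (λ l → f l + g l) ≈ sumFrom lo k f + sumFrom lo k g
  sumFrom-+ lo zero    f g = sym (+-identityʳ 0#)
  sumFrom-+ lo (suc k) f g = trans (+-congˡ (sumFrom-+ (suc lo) k f g)) (interchange _ _ _ _)

  sumFrom-*ˡ : ∀ lo k x (f : Series) → sumFrom lo k (λ l → x * f l) ≈ x * sumFrom lo k f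
  sumFrom-*ˡ lo zero    x f = sym (zeroʳ x)
  sumFrom-*ˡ lo (suc k) x f = trans (+-congˡ (sumFrom-*ˡ (suc lo) k x f)) (sym (distribˡ x _ _))

  sumFrom-suc : ∀ lo k (f : Series) → sumFrom (suc lo) k f ≡ sumFrom lo k (f ∘ suc)
  sumFrom-suc lo zero    f = ≡.refl
  sumFrom-suc lo (suc k) f = ≡.cong (f (suc lo) +_) (sumFrom-suc (suc lo) k f)

  sumFrom-split : ∀ lo m k (f : Series) →
    sumFrom lo (m ℕ.+ k) f ≈ sumFrom lo m f + sumFrom (lo ℕ.+ m) k f
  sumFrom-split lo zero    k f rewrite ℕₚ.+-identityʳ lo = sym (+-identityˡ _)
  sumFrom-split lo (suc m) k f rewrite ℕₚ.+-suc lo m =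
    trans (+-congˡ (sumFrom-split (suc lo) m k f)) (sym (+-assoc (f lo) _ _))

  shift-sumFrom : ∀ lo k (F : ℕ → Series) n →
    shift (λ m → sumFrom lo k (λ l → F l m)) n ≈ sumFrom lo k (λ l → shift (F l) n)
  shift-sumFrom lo k F zero    = sym (sumFrom-0# lo k)
  shift-sumFrom lo k F (suc n) = refl

  -- If hi < lo, no term survives and the right-hand side is the empty sum.
  sumFrom-window : ∀ {n lo hi} {f g : Series} → hi < n →
    (∀ {l} → l < lo → f l ≈ 0#) → (∀ {l} → lo ≤ l → l ≤ hi → f l ≈ g l) →
    (∀ {l} → hi < l → f l ≈ 0#) → sumFrom 0 n f ≈ sumRange lo hi g
  sumFrom-window {n} {lo} {hi} {f} {g} hi<n below inside above with lo ≤? suc hi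
  ... | no lo≰1+hi rewrite ℕₚ.m≤n⇒m∸n≡0 (ℕₚ.<⇒≤ (ℕₚ.≰⇒> lo≰1+hi)) = sumFrom-zero 0 n vanishes
    where
    vanishes : ∀ {l} → 0 ≤ l → l < n → f l ≈ 0#
    vanishes {l} _ _ with l <? lo
    ... | yes l<lo = below l<lo
    ... | no l≮lo  = above (ℕₚ.<⇒≤ (ℕₚ.<-≤-trans (ℕₚ.≰⇒> lo≰1+hi) (ℕₚ.≮⇒≥ l≮lo)))
  ... | yes lo≤1+hi = begin
    sumFrom 0 n f                                  ≡⟨ ≡.cong (λ m → sumFrom 0 m f) lo+[k+r]≡n ⟨
    sumFrom 0 (lo ℕ.+ (k ℕ.+ r)) f                 ≈⟨ sumFrom-split 0 lo (k ℕ.+ r) f ⟩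
    sumFrom 0 lo f + sumFrom lo (k ℕ.+ r) f
      ≈⟨ +-cong (sumFrom-zero 0 lo λ _ → below) (sumFrom-split lo k r f) ⟩
    0# + (sumFrom lo k f + sumFrom (lo ℕ.+ k) r f) ≈⟨ +-identityˡ _ ⟩
    sumFrom lo k f + sumFrom (lo ℕ.+ k) r f
      ≈⟨ +-cong (sumFrom-cong lo k middle) (sumFrom-zero (lo ℕ.+ k) r top) ⟩
    sumRange lo hi g + 0#                          ≈⟨ +-identityʳ _ ⟩
    sumRange lo hi g                               ∎
    where
    k r : ℕ
    k = suc hi ∸ lo
    r = n ∸ suc hi
    lo+k≡1+hi : lo ℕ.+ k ≡ suc hi
    lo+k≡1+hi = ℕₚ.m+[n∸m]≡n lo≤1+hi
    lo+[k+r]≡n : lo ℕ.+ (k ℕ.+ r) ≡ n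
    lo+[k+r]≡n = ≡.trans (≡.sym (ℕₚ.+-assoc lo k r))
      (≡.trans (≡.cong (ℕ._+ r) lo+k≡1+hi) (ℕₚ.m+[n∸m]≡n hi<n))
    middle : ∀ {l} → lo ≤ l → l < lo ℕ.+ k → f l ≈ g l
    middle {l} lo≤l l<lo+k = inside lo≤l (ℕₚ.≤-pred (≡.subst (l <_) lo+k≡1+hi l<lo+k))
    top : ∀ {l} → lo ℕ.+ k ≤ l → l < lo ℕ.+ k ℕ.+ r → f l ≈ 0#
    top {l} lo+k≤l _ = above (≡.subst (_≤ l) lo+k≡1+hi lo+k≤l)

  coeff-polyAdd : ∀ p r n → coeff (polyAdd p r) n ≈ coeff p n + coeff r n
  coeff-polyAdd []       r        n       = sym (+-identityˡ _)
  coeff-polyAdd (x ∷ xs) []       n       = sym (+-identityʳ _)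
  coeff-polyAdd (x ∷ xs) (y ∷ ys) zero    = refl
  coeff-polyAdd (x ∷ xs) (y ∷ ys) (suc n) = coeff-polyAdd xs ys n

  coeff-map-* : ∀ x ys n → coeff (map (x *_) ys) n ≈ x * coeff ys n
  coeff-map-* x []       n       = sym (zeroʳ x)
  coeff-map-* x (y ∷ ys) zero    = refl
  coeff-map-* x (y ∷ ys) (suc n) = coeff-map-* x ys n

  coeff-polyMul-∷ : ∀ x xs ys n →
    coeff (polyMul (x ∷ xs) ys) n ≈ x * coeff ys n + shift (coeff (polyMul xs ys)) n
  coeff-polyMul-∷ x xs ys n = trans (coeff-polyAdd (map (x *_) ys) (0# ∷ polyMul xs ys) n)
    (+-cong (coeff-map-* x ys n) (coeff-0∷ n))
    where
    coeff-0∷ : ∀ n → coeff (0# ∷ polyMul xs ys) n ≈ shift (coeff (polyMul xs ys)) n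
    coeff-0∷ zero    = refl
    coeff-0∷ (suc n) = refl

  coeff-polyMul-linFactor : ∀ s p n →
    coeff (polyMul (linFactor s) p) n ≈ s * coeff p n + shift (coeff p) n
  coeff-polyMul-linFactor s p n =
    trans (coeff-polyMul-∷ s (1# ∷ []) p n) (+-congˡ (shift-cong coeff-1* n))
    where
    coeff-1* : ∀ m → coeff (polyMul (1# ∷ []) p) m ≈ coeff p m
    coeff-1* m = trans (coeff-polyMul-∷ 1# [] p m)
      (trans (+-congˡ (shift-0# m)) (trans (+-identityʳ _) (*-identityˡ _)))

  a-suc : ∀ q (t : Fin (suc q) → Carrier) n →
    a (suc q) t n ≈ t zero * a q (t ∘ suc) n + shift (a q (t ∘ suc)) n
  a-suc q t = coeff-polyMul-linFactor (t zero) (polyProd q (linFactor ∘ t ∘ suc))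

  -- Uses x² + s x + s = x² + s (1 + x).
  b-suc : ∀ q (t : Fin (suc q) → Carrier) n →
    b (suc q) t n ≈
      t zero * (b q (t ∘ suc) n + shift (b q (t ∘ suc)) n) + shift (shift (b q (t ∘ suc))) n
  b-suc q t n = trans (coeff-polyMul-∷ s (linFactor s) p n)
    (trans (+-congˡ (shift-cong (coeff-polyMul-linFactor s p) n)) (regroup n))
    where
    s = t zero
    p = polyProd q (quadFactor ∘ t ∘ suc)
    B = coeff p
    regroup : ∀ n →
      s * B n + shift (λ m → s * B m + shift B m) n ≈ s * (B n + shift B n) + shift (shift B) n
    regroup zero    = +-congʳ (*-congˡ (sym (+-identityʳ _)))
    regroup (suc n) = trans (sym (+-assoc _ _ _)) (+-congʳ (sym (distribˡ s _ _)))

  a-vanishes : ∀ q t {n} → q < n → a q t n ≈ 0#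
  a-vanishes zero    t {suc n} _         = refl
  a-vanishes (suc q) t {suc n} (s≤s q<n) = trans (a-suc q t (suc n))
    (trans (+-cong (trans (*-congˡ (a-vanishes q (t ∘ suc) (ℕₚ.m<n⇒m<1+n q<n))) (zeroʳ _))
                   (a-vanishes q (t ∘ suc) q<n))
           (+-identityˡ 0#))

  shiftedBinomial-pascal× : ∀ m l x h →
    shiftedBinomial (suc m) l h × x ≈
      shiftedBinomial m l h × x + shift (λ h → shiftedBinomial m l h × x) h
  shiftedBinomial-pascal× m l x zero    =
    trans (×-congˡ (shiftedBinomial-pascal₀ m l)) (sym (+-identityʳ _))
  shiftedBinomial-pascal× m l x (suc h) = trans (×-congˡ (shiftedBinomial-pascal m l h))
    (×-homo-+ x (shiftedBinomial m l (suc h)) (shiftedBinomial m l h))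

  expansionTerm : (q : ℕ) → (Fin q → Carrier) → ℕ → Series
  expansionTerm q t l h = shiftedBinomial (q ∸ l) l h × a q t l

  -- The coefficient of xʰ in Σ_{l<N} a(l) x²ˡ (1 + x)^(q ∸ l).
  expansion : (q : ℕ) → (Fin q → Carrier) → ℕ → Series
  expansion q t N h = sumFrom 0 N (λ l → expansionTerm q t l h)

  -- For l > q the exponent suc q ∸ l is not suc (q ∸ l), but then a(l) = 0.
  expansionTerm-pascal : ∀ q t l h →
    shiftedBinomial (suc q ∸ l) l h × a q t l ≈ expansionTerm q t l h + shift (expansionTerm q t l) h
  expansionTerm-pascal q t l h with l ≤? q
  ... | yes l≤q rewrite ℕₚ.+-∸-assoc 1 l≤q = shiftedBinomial-pascal× (q ∸ l) l (a q t l) h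
  ... | no l≰q = trans (vanishes (shiftedBinomial (suc q ∸ l) l h))
    (sym (trans (+-cong (term≈0 h) (trans (shift-cong term≈0 h) (shift-0# h))) (+-identityʳ 0#)))
    where
    vanishes : ∀ n → n × a q t l ≈ 0#
    vanishes n = trans (×-congʳ n (a-vanishes q t (ℕₚ.≰⇒> l≰q))) (×-zeroʳ n)
    term≈0 : ∀ m → expansionTerm q t l m ≈ 0#
    term≈0 m = vanishes (shiftedBinomial (q ∸ l) l m)

  expansion-suc : ∀ q (t : Fin (suc q) → Carrier) N h →
    expansion (suc q) t (suc N) h ≈
      t zero * (expansion q (t ∘ suc) (suc N) h + shift (expansion q (t ∘ suc) (suc N)) h)
        + shift (shift (expansion q (t ∘ suc) N)) h
  expansion-suc q t N h = begin
    expansion (suc q) t (suc N) h                  ≈⟨ sumFrom-cong 0 (suc N) (λ {l} _ _ → split l) ⟩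
    sumFrom 0 (suc N) (λ l → s * X l + Y l)        ≈⟨ sumFrom-+ 0 (suc N) _ Y ⟩
    sumFrom 0 (suc N) (λ l → s * X l) + sumFrom 0 (suc N) Y
      ≈⟨ +-cong (trans (sumFrom-*ˡ 0 (suc N) s X) (*-congˡ sumX)) sumY ⟩
    s * (E (suc N) h + shift (E (suc N)) h) + shift (shift (E N)) h ∎
    where
    s = t zero
    t′ = t ∘ suc
    E = expansion q t′
    D : ℕ → ℕ
    D l = shiftedBinomial (suc q ∸ l) l h
    X Y : Series
    X l = D l × a q t′ l
    Y l = D l × shift (a q t′) l
    split : ∀ l → expansionTerm (suc q) t l h ≈ s * X l + Y l
    split l = trans (×-congʳ (D l) (a-suc q t l))
      (trans (×-distrib-+ _ _ (D l)) (+-congʳ (sym (×-comm-* (D l) s _))))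
    sumX : sumFrom 0 (suc N) X ≈ E (suc N) h + shift (E (suc N)) h
    sumX = trans (sumFrom-cong 0 (suc N) (λ {l} _ _ → expansionTerm-pascal q t′ l h))
      (trans (sumFrom-+ 0 (suc N) _ _) (+-congˡ (sym (shift-sumFrom 0 (suc N) (expansionTerm q t′) h))))
    Y-suc : ∀ l h →
      shiftedBinomial (q ∸ l) (suc l) h × a q t′ l ≈ shift (shift (expansionTerm q t′ l)) h
    Y-suc l zero          = refl
    Y-suc l (suc zero)    = refl
    Y-suc l (suc (suc h)) = refl
    sumY : sumFrom 0 (suc N) Y ≈ shift (shift (E N)) h
    sumY = begin
      Y 0 + sumFrom 1 N Y
        ≈⟨ +-cong (×-zeroʳ (D 0)) (reflexive (sumFrom-suc 0 N Y)) ⟩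
      0# + sumFrom 0 N (Y ∘ suc)
        ≈⟨ +-identityˡ _ ⟩
      sumFrom 0 N (Y ∘ suc)
        ≈⟨ sumFrom-cong 0 N (λ {l} _ _ → Y-suc l h) ⟩
      sumFrom 0 N (λ l → shift (shift (expansionTerm q t′ l)) h)
        ≈⟨ shift-sumFrom 0 N (shift ∘ expansionTerm q t′) h ⟨
      shift (λ m → sumFrom 0 N (λ l → shift (expansionTerm q t′ l) m)) h
        ≈⟨ shift-cong (shift-sumFrom 0 N (expansionTerm q t′)) h ⟨
      shift (shift (E N)) h
        ∎

  b≈expansion : ∀ q t N → q < N → ∀ h → b q t h ≈ expansion q t N h
  b≈expansion zero t (suc N) _ h = sym (trans (+-congˡ tail≈0) (trans (+-identityʳ _) (head h)))
    where
    tail≈0 : sumFrom 1 N (λ l → expansionTerm 0 t l h) ≈ 0#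
    tail≈0 = sumFrom-zero 1 N λ {l} 1≤l _ →
      trans (×-congʳ (shiftedBinomial (0 ∸ l) l h) (a-vanishes 0 t 1≤l))
            (×-zeroʳ (shiftedBinomial (0 ∸ l) l h))
    head : ∀ h → expansionTerm 0 t 0 h ≈ b 0 t h
    head zero    = +-identityʳ 1#
    head (suc h) = refl
  b≈expansion (suc q) t (suc N) (s≤s q<N) h = begin
    b (suc q) t h                                   ≈⟨ b-suc q t h ⟩
    t zero * (B h + shift B h) + shift (shift B) h
      ≈⟨ +-cong (*-congˡ (+-cong (IH (suc N) q<1+N h) (shift-cong (IH (suc N) q<1+N) h)))
                (shift-cong (shift-cong (IH N q<N)) h) ⟩
    t zero * (E (suc N) h + shift (E (suc N)) h) + shift (shift (E N)) h
      ≈⟨ expansion-suc q t N h ⟨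
    expansion (suc q) t (suc N) h                   ∎
    where
    B = b q (t ∘ suc)
    E = expansion q (t ∘ suc)
    IH = b≈expansion q (t ∘ suc)
    q<1+N = ℕₚ.m<n⇒m<1+n q<N

open import Data.Nat using (_*_)

proposition2p1 : {c ℓ : Level} (R : CommutativeRing c ℓ) (q : ℕ) → 1 ≤ q →
    (t : Fin q → CommutativeRing.Carrier R) → (h : ℕ) → h ≤ 2 * q →
    CommutativeRing._≈_ R (PolyDefs.b R q t h)
      (PolyDefs.sumRange R (h ∸ q) (h / 2)
        (λ l → PolyDefs._·_ R ((q ∸ l) C (h ∸ 2 * l)) (PolyDefs.a R q t l)))
proposition2p1 R q _ t h h≤2q =
  trans (b≈expansion q t (suc q) ℕₚ.≤-refl h) (sumFrom-window (s≤s h/2≤q) below inside above)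
  where
  open CommutativeRing R using (_≈_; 0#; trans; reflexive; semiring)
  open SemiringMult semiring using (×-congˡ)
  open PolyDefs R using (a; _·_)
  open Expansion R
  h/2≤q : h / 2 ≤ q
  h/2≤q = ℕₚ.*-cancelˡ-≤ 2 (ℕₚ.≤-trans (m≤n/2⇒2*m≤n ℕₚ.≤-refl) h≤2q)
  below : ∀ {l} → l < h ∸ q → expansionTerm q t l h ≈ 0#
  below {l} l<h∸q = ×-congˡ (m<h∸2*l⇒shiftedBinomial≡0 l (n≤2*o⇒m<n∸o⇒o∸m<n∸2*m h≤2q l<h∸q))
  inside : ∀ {l} → h ∸ q ≤ l → l ≤ h / 2 → expansionTerm q t l h ≈ ((q ∸ l) C (h ∸ 2 * l)) · a q t l
  inside {l} _ l≤h/2 = trans (×-congˡ (2*l≤h⇒shiftedBinomial≡C l (m≤n/2⇒2*m≤n l≤h/2)))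
    (reflexive (≡.sym (·≡× ((q ∸ l) C (h ∸ 2 * l)) (a q t l))))
  above : ∀ {l} → h / 2 < l → expansionTerm q t l h ≈ 0#
  above {l} h/2<l = ×-congˡ (h<2*l⇒shiftedBinomial≡0 l (n/2<m⇒n<2*m h/2<l))
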